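{- Let $m=4$ and $n=7$. Let $\lambda$ be an $m$-partition of $dn$ and let $\bar\lambda=(\lambda_2,\lambda_3,\lambda_4)$ (trailing zeros dropped) be $\lambda$ without its first part. If $\bar\lambda\in Y$, where $Y=\{(1),(1,1),(1,1,1),(2,1),(2,1,1),(2,2,1),(3,1),(3,1,1),(3,2,1),(3,3),(3,3,1),(3,3,2),(3,3,3),(4,1,1),(4,3,3),(5,1,1),(5,5,5),(6,1,1)\}$, then $a_\lambda(d[n])=0$.
   Context: An $m$-partition of $N$ is a nonincreasing list of $m$ nonnegative integers summing to $N$. The plethysm coefficient $a_\lambda(d[n])$ is the coefficient of the Schur function $s_\lambda$ in $h_d[h_n]$, equivalently the multiplicity of the irreducible $\mathsf{GL}_m$-representation of highest weight $\lambda$ in $\mathrm{Sym}^d(\mathrm{Sym}^n\mathbb{C}^m)$. -}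

module Defs where

open import Data.Nat using (ℕ; zero; suc; _+_; _*_; _∸_; _≥_; _≤?_)
open import Data.Integer using (ℤ; +_; -_) renaming (_*_ to _*ℤ_; _+_ to _+ℤ_)
open import Data.List using (List; []; _∷_; map; concatMap; upTo; foldr)
open import Data.Nat.ListAction using (sum)
open import Data.Vec using (Vec; []; _∷_)
open import Data.Maybe using (Maybe; just; nothing; maybe)
open import Data.Product using (_×_; _,_)
open import Data.Unit using (⊤)
open import Relation.Nullary using (yes; no)

Nonincreasing : ∀ {m} → Vec ℕ m → Set
Nonincreasing [] = ⊤
Nonincreasing (x ∷ []) = ⊤
Nonincreasing (x ∷ y ∷ xs) = (x ≥ y) × Nonincreasing (y ∷ xs)

vsum : ∀ {m} → Vec ℕ m → ℕ
vsum [] = 0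
vsum (x ∷ xs) = x + vsum xs

IsPartition : (m N : ℕ) → Vec ℕ m → Set
IsPartition m N λ′ = Nonincreasing λ′ × vsum λ′ ≡′ N
  where open import Relation.Binary.PropositionalEquality renaming (_≡_ to _≡′_)

monomials : (m n : ℕ) → List (Vec ℕ m)
monomials zero zero = [] ∷ []
monomials zero (suc n) = []
monomials (suc m) n = concatMap (λ k → map (k ∷_) (monomials m (n ∸ k))) (upTo (suc n))

vadd : ∀ {m} → Vec ℕ m → Vec ℕ m → Vec ℕ m
vadd [] [] = []
vadd (x ∷ xs) (y ∷ ys) = x + y ∷ vadd xs ys

scale : ∀ {m} → ℕ → Vec ℕ m → Vec ℕ m
scale k [] = []
scale k (x ∷ xs) = k * x ∷ scale k xs

vsub? : ∀ {m} → Vec ℕ m → Vec ℕ m → Maybe (Vec ℕ m)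
vsub? [] [] = just []
vsub? (x ∷ xs) (y ∷ ys) with y ≤? x | vsub? xs ys
... | yes _ | just r = just (x ∸ y ∷ r)
... | yes _ | nothing = nothing
... | no _ | _ = nothing

isZeroVec : ∀ {m} → Vec ℕ m → ℕ
isZeroVec [] = 1
isZeroVec (zero ∷ xs) = isZeroVec xs
isZeroVec (suc _ ∷ xs) = 0

-- multisetCount ms d μ = number of multisets of size d of elements of the
-- list ms (monomials, assumed distinct) whose product (sum of exponent
-- vectors) is x^μ.
multisetCount : ∀ {m} → List (Vec ℕ m) → ℕ → Vec ℕ m → ℕ
multisetCount [] zero μ = isZeroVec μ
multisetCount [] (suc d) μ = 0
multisetCount (v ∷ vs) d μ =
  sum (map (λ k → maybe (multisetCount vs (d ∸ k)) 0 (vsub? μ (scale k v))) (upTo (suc d)))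

-- coefficient of x^μ in h_d[h_n](x₁,…,x_m), i.e. the dimension of the
-- μ-weight space of Sym^d(Sym^n ℂ^m)
hdhnCoeff : (m d n : ℕ) → Vec ℕ m → ℕ
hdhnCoeff m d n μ = multisetCount (monomials m n) d μ

-- signed permutations of a vector: (sign w, w·v) for all w ∈ S_m
insertions : ∀ {A : Set} {k} → A → Vec A k → List (ℤ × Vec A (suc k))
insertions x [] = (+ 1 , x ∷ []) ∷ []
insertions x (y ∷ ys) =
  (+ 1 , x ∷ y ∷ ys) ∷ map (λ { (s , l) → (- s , y ∷ l) }) (insertions x ys)

signedPerms : ∀ {A : Set} {k} → Vec A k → List (ℤ × Vec A k)
signedPerms [] = (+ 1 , []) ∷ []
signedPerms (x ∷ xs) =
  concatMap (λ { (s , p) → map (λ { (t , q) → (s *ℤ t , q) }) (insertions x p) })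
            (signedPerms xs)

staircase : (m : ℕ) → Vec ℕ m
staircase zero = []
staircase (suc m) = m ∷ staircase m

sumℤ : List ℤ → ℤ
sumℤ = foldr _+ℤ_ (+ 0)

-- Plethysm coefficient a_λ(d[n]) = coefficient of s_λ(x₁,…,x_m) in
-- h_d[h_n](x₁,…,x_m), extracted in the standard way as the coefficient of
-- x^{λ+δ} in a_δ · h_d[h_n], where a_δ = Σ_{w∈S_m} sgn(w) x^{w δ}:
--   a_λ(d[n]) = Σ_{w ∈ S_m} sgn(w) [x^{λ+δ-wδ}] h_d[h_n].
plethysmCoeff : (m d n : ℕ) → Vec ℕ m → ℤ
plethysmCoeff m d n λ′ =
  sumℤ (map (λ { (s , wδ) → s *ℤ maybe (λ μ → + hdhnCoeff m d n μ) (+ 0) (vsub? (vadd λ′ δ) wδ) })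
            (signedPerms δ))
  where δ = staircase m

-- λ̄ = (λ₂,…,λ_m) : λ without its first part (kept with trailing zeros)
dropFirst : ∀ {m} → Vec ℕ (suc m) → Vec ℕ m
dropFirst (_ ∷ xs) = xs

-- The set Y, each element padded with zeros to length 3
Y : List (Vec ℕ 3)
Y = (1 ∷ 0 ∷ 0 ∷ []) ∷ (1 ∷ 1 ∷ 0 ∷ []) ∷ (1 ∷ 1 ∷ 1 ∷ []) ∷ (2 ∷ 1 ∷ 0 ∷ []) ∷
    (2 ∷ 1 ∷ 1 ∷ []) ∷ (2 ∷ 2 ∷ 1 ∷ []) ∷ (3 ∷ 1 ∷ 0 ∷ []) ∷ (3 ∷ 1 ∷ 1 ∷ []) ∷
    (3 ∷ 2 ∷ 1 ∷ []) ∷ (3 ∷ 3 ∷ 0 ∷ []) ∷ (3 ∷ 3 ∷ 1 ∷ []) ∷ (3 ∷ 3 ∷ 2 ∷ []) ∷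
    (3 ∷ 3 ∷ 3 ∷ []) ∷ (4 ∷ 1 ∷ 1 ∷ []) ∷ (4 ∷ 3 ∷ 3 ∷ []) ∷ (5 ∷ 1 ∷ 1 ∷ []) ∷
    (5 ∷ 5 ∷ 5 ∷ []) ∷ (6 ∷ 1 ∷ 1 ∷ []) ∷ []

-- Homogeneity eliminates the first row: the coefficient of x^(x ∷ σ) in h_d[h_n](x₁,…,x₄)
-- with x + |σ| = dn equals the number of d-multisets of monomials of degree ≤ n in three
-- variables with product x^σ.  So the alternant formula expresses a_λ(d[7]) as a signed sum of
-- such counts at the points λ̄ + δ̄ − (wδ)‾, which for λ̄ ∈ Y all lie below the box (9,7,6).
-- The counts are computed monomial by monomial (a given monomial is used at least once or not
-- at all), as a table of polynomials truncated to the box.  Since the constant monomial is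
-- among the ones counted, the count at σ no longer changes once d ≥ |σ|, and |σ| ≤ 19 below
-- the box; so it suffices to check that the signed sums vanish for d = 1, …, 19.  For d = 0
-- the only partition is 0 ∉ Y.
module Submission where

open import Defs
open import Data.Nat using (ℕ; _*_)
open import Data.Integer using (+_)
open import Data.Vec using (Vec)
open import Data.List.Membership.Propositional using (_∈_)
open import Relation.Binary.PropositionalEquality using (_≡_)

open import Data.Bool using (Bool; T; true; false)
open import Data.Bool.ListAction using (all)
open import Data.Empty using (⊥-elim)
open import Data.Fin using (Fin; zero; suc; toℕ; fromℕ<)
open import Data.Fin.Properties using (toℕ-fromℕ<)
open import Data.Integer as ℤ using (ℤ)
open import Data.List as List using (List; []; _∷_; upTo; applyUpTo)
open import Data.List.Properties using (map-cong; map-cong-local; map-upTo; map-applyUpTo)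
open import Data.List.Membership.Propositional.Properties using (∈-allFin)
open import Data.List.Relation.Unary.All as All using (All; []; _∷_)
import Data.List.Relation.Unary.All.Properties as All
open import Data.Maybe as Maybe using (just; nothing; maybe′)
open import Data.Maybe.Properties using (maybe′-map)
open import Data.Nat
open import Data.Nat.ListAction using (sum)
open import Data.Nat.Properties
open import Algebra.Properties.CommutativeSemigroup +-commutativeSemigroup
  using (interchange; x∙yz≈y∙xz; xy∙z≈y∙xz)
open import Data.Product using (_×_; _,_)
open import Data.Sum using (inj₁; inj₂)
open import Data.Unit using (tt)
open import Data.Vec as Vec using ([]; _∷_)
open import Data.Vec.Properties using (lookup-replicate)
open import Data.Vec.Relation.Binary.Pointwise.Inductive as Pointwise using (Pointwise; []; _∷_)
open import Function using (_∘_)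
open import Relation.Nullary using (Dec; yes; no)
open import Relation.Nullary.Decidable using (from-yes; _×-dec_)
open import Relation.Binary.PropositionalEquality

private variable
  m : ℕ

_≤ᵥ_ _<ᵥ_ : Vec ℕ m → Vec ℕ m → Set
_≤ᵥ_ = Pointwise _≤_
_<ᵥ_ = Pointwise _<_

vadd-assoc : ∀ (u v w : Vec ℕ m) → vadd (vadd u v) w ≡ vadd u (vadd v w)
vadd-assoc []       []       []       = refl
vadd-assoc (x ∷ xs) (y ∷ ys) (z ∷ zs) = cong₂ _∷_ (+-assoc x y z) (vadd-assoc xs ys zs)

≤ᵥ-vadd : ∀ (v r : Vec ℕ m) → r ≤ᵥ vadd v r
≤ᵥ-vadd []       []       = []
≤ᵥ-vadd (x ∷ xs) (y ∷ ys) = m≤n+m y x ∷ ≤ᵥ-vadd xs ys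

vsum-vadd : ∀ (u v : Vec ℕ m) → vsum (vadd u v) ≡ vsum u + vsum v
vsum-vadd []       []       = refl
vsum-vadd (x ∷ xs) (y ∷ ys) =
  trans (cong (_+_ (x + y)) (vsum-vadd xs ys)) (interchange x y (vsum xs) (vsum ys))

vsum-split : ∀ {v r σ : Vec ℕ m} → vadd v r ≡ σ → vsum v + vsum r ≡ vsum σ
vsum-split {v = v} {r} refl = sym (vsum-vadd v r)

vsum-dropFirst : ∀ (v : Vec ℕ (suc m)) → vsum (dropFirst v) ≤ vsum v
vsum-dropFirst (y ∷ τ) = m≤n+m (vsum τ) y

dropFirst-bounded : ∀ {n} {L : List (Vec ℕ (suc m))} → All (λ v → vsum v ≡ n) L →
                    All (λ v → vsum v ≤ n) (List.map dropFirst L)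
dropFirst-bounded = All.gmap⁺ λ {v} v≡n → subst (vsum (dropFirst v) ≤_) v≡n (vsum-dropFirst v)

scale-zero : ∀ (v : Vec ℕ m) → scale 0 v ≡ Vec.replicate m 0
scale-zero []       = refl
scale-zero (_ ∷ xs) = cong (0 ∷_) (scale-zero xs)

scale-suc : ∀ k (v : Vec ℕ m) → scale (suc k) v ≡ vadd v (scale k v)
scale-suc k []       = refl
scale-suc k (x ∷ xs) = cong (x + k * x ∷_) (scale-suc k xs)

isZeroVec-nonzero : ∀ (σ : Vec ℕ m) → 0 < vsum σ → isZeroVec σ ≡ 0
isZeroVec-nonzero (zero ∷ σ)  0<σ = isZeroVec-nonzero σ 0<σ
isZeroVec-nonzero (suc _ ∷ _) _   = refl

vsub?-∷-≤ : ∀ {x y} (xs ys : Vec ℕ m) → y ≤ x →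
            vsub? (x ∷ xs) (y ∷ ys) ≡ Maybe.map (x ∸ y ∷_) (vsub? xs ys)
vsub?-∷-≤ {x = x} {y} xs ys y≤x with y ≤? x | vsub? xs ys
... | yes _   | just _  = refl
... | yes _   | nothing = refl
... | no y≰x  | _       = ⊥-elim (y≰x y≤x)

vsub?-∷-≰ : ∀ {x y} (xs ys : Vec ℕ m) → y ≰ x → vsub? (x ∷ xs) (y ∷ ys) ≡ nothing
vsub?-∷-≰ {x = x} {y} xs ys y≰x with y ≤? x | vsub? xs ys
... | yes y≤x | _ = ⊥-elim (y≰x y≤x)
... | no _    | _ = refl

vsub?-suc : ∀ x y (xs ys : Vec ℕ m) → vsub? (suc x ∷ xs) (suc y ∷ ys) ≡ vsub? (x ∷ xs) (y ∷ ys)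
vsub?-suc x y xs ys = by-cases (y ≤? x)
  where
  by-cases : Dec (y ≤ x) → vsub? (suc x ∷ xs) (suc y ∷ ys) ≡ vsub? (x ∷ xs) (y ∷ ys)
  by-cases (yes y≤x) = trans (vsub?-∷-≤ xs ys (s≤s y≤x)) (sym (vsub?-∷-≤ xs ys y≤x))
  by-cases (no y≰x)  = trans (vsub?-∷-≰ xs ys (y≰x ∘ s≤s⁻¹)) (sym (vsub?-∷-≰ xs ys y≰x))

vsub?-zero : ∀ (σ : Vec ℕ m) → vsub? σ (Vec.replicate m 0) ≡ just σ
vsub?-zero []       = refl
vsub?-zero (x ∷ xs) = trans (vsub?-∷-≤ xs _ z≤n) (cong (Maybe.map (x ∷_)) (vsub?-zero xs))

vsub?-sound : ∀ (μ ν : Vec ℕ m) {r} → vsub? μ ν ≡ just r → vadd ν r ≡ μ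
vsub?-sound []       []       refl = refl
vsub?-sound (x ∷ xs) (y ∷ ys) eq with y ≤? x | vsub? xs ys in e
vsub?-sound (x ∷ xs) (y ∷ ys) refl | yes y≤x | just _ =
  cong₂ _∷_ (m+[n∸m]≡n y≤x) (vsub?-sound xs ys e)

vsub?-complete : ∀ (ν r : Vec ℕ m) → vsub? (vadd ν r) ν ≡ just r
vsub?-complete []       []       = refl
vsub?-complete (y ∷ ys) (z ∷ zs) = trans (vsub?-∷-≤ (vadd ys zs) ys (m≤m+n y z))
  (cong₂ (λ a → Maybe.map (a ∷_)) (m+n∸m≡n y z) (vsub?-complete ys zs))

vsub?-nothing : ∀ {μ ν r : Vec ℕ m} → vsub? μ ν ≡ nothing → vadd ν r ≢ μ
vsub?-nothing {ν = ν} {r} eq refl with () ← trans (sym (vsub?-complete ν r)) eq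

vsub?-maybe-cong : ∀ {A : Set} {f g : Vec ℕ m → A} {z : A} (μ ν : Vec ℕ m) →
                   (∀ r → vadd ν r ≡ μ → f r ≡ g r) →
                   maybe′ f z (vsub? μ ν) ≡ maybe′ g z (vsub? μ ν)
vsub?-maybe-cong μ ν f≡g with vsub? μ ν in eq
... | just r  = f≡g r (vsub?-sound μ ν eq)
... | nothing = refl

-- If f lists the coefficients of a series F, then f ↑ v lists those of x^v · F:
-- (f ↑ v) σ is f (σ − v), or 0 unless v ≤ σ.
_↑_ : (Vec ℕ m → ℕ) → Vec ℕ m → Vec ℕ m → ℕ
(f ↑ v) σ = maybe′ f 0 (vsub? σ v)

↑-elim : ∀ (P : ℕ → Set) (f : Vec ℕ m → ℕ) (v σ : Vec ℕ m) →
         P 0 → (∀ r → vadd v r ≡ σ → P (f r)) → P ((f ↑ v) σ)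
↑-elim P f v σ P0 Pf with vsub? σ v in eq
... | just r  = Pf r (vsub?-sound σ v eq)
... | nothing = P0

↑-vadd : ∀ (f : Vec ℕ m → ℕ) (u w σ : Vec ℕ m) → (f ↑ vadd u w) σ ≡ ((f ↑ w) ↑ u) σ
↑-vadd f u w σ with vsub? σ (vadd u w) in eq
... | just r  = sym (begin
  ((f ↑ w) ↑ u) σ                   ≡⟨ cong ((f ↑ w) ↑ u) uwr≡σ ⟨
  ((f ↑ w) ↑ u) (vadd u (vadd w r)) ≡⟨ cong (maybe′ (f ↑ w) 0) (vsub?-complete u (vadd w r)) ⟩
  (f ↑ w) (vadd w r)                ≡⟨ cong (maybe′ f 0) (vsub?-complete w r) ⟩
  f r                               ∎)
  where
  open ≡-Reasoning
  uwr≡σ : vadd u (vadd w r) ≡ σ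
  uwr≡σ = trans (sym (vadd-assoc u w r)) (vsub?-sound σ (vadd u w) eq)
... | nothing =
  ↑-elim (0 ≡_) (f ↑ w) u σ refl λ s us≡σ → ↑-elim (0 ≡_) f w s refl λ r wr≡s →
    ⊥-elim (vsub?-nothing eq (trans (vadd-assoc u w r) (trans (cong (vadd u) wr≡s) us≡σ)))

↑-+ : ∀ (f g : Vec ℕ m → ℕ) v σ → ((λ r → f r + g r) ↑ v) σ ≡ (f ↑ v) σ + (g ↑ v) σ
↑-+ f g v σ with vsub? σ v
... | just _  = refl
... | nothing = refl

sum-map-↑ : ∀ {A : Set} (g : A → Vec ℕ m → ℕ) (xs : List A) v σ →
            sum (List.map (λ k → (g k ↑ v) σ) xs) ≡ ((λ r → sum (List.map (λ k → g k r) xs)) ↑ v) σ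
sum-map-↑ g []       v σ = ↑-elim (0 ≡_) (λ _ → 0) v σ refl (λ _ _ → refl)
sum-map-↑ g (x ∷ xs) v σ =
  trans (cong (_+_ ((g x ↑ v) σ)) (sum-map-↑ g xs v σ)) (sym (↑-+ (g x) _ v σ))

↑-scale-zero : ∀ (f : Vec ℕ m → ℕ) v σ → (f ↑ scale 0 v) σ ≡ f σ
↑-scale-zero f v σ = cong (maybe′ f 0) (trans (cong (vsub? σ) (scale-zero v)) (vsub?-zero σ))

multisetCount-∷-zero : ∀ (v : Vec ℕ m) L σ → multisetCount (v ∷ L) 0 σ ≡ multisetCount L 0 σ
multisetCount-∷-zero v L σ = trans (+-identityʳ _) (↑-scale-zero (multisetCount L 0) v σ)

multisetCount-∷-suc : ∀ (v : Vec ℕ m) L d σ →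
  multisetCount (v ∷ L) (suc d) σ ≡ multisetCount L (suc d) σ + (multisetCount (v ∷ L) d ↑ v) σ
multisetCount-∷-suc v L d σ = cong₂ _+_ (↑-scale-zero (multisetCount L (suc d)) v σ) (begin
  sum (List.map copies (applyUpTo suc (suc d)))
    ≡⟨ cong sum (trans (map-applyUpTo suc copies (suc d)) (sym (map-upTo (copies ∘ suc) (suc d)))) ⟩
  sum (List.map (copies ∘ suc) (upTo (suc d)))
    ≡⟨ cong sum (map-cong (λ k → trans (cong (λ u → (multisetCount L (d ∸ k) ↑ u) σ) (scale-suc k v))
                                       (↑-vadd _ v (scale k v) σ)) (upTo (suc d))) ⟩
  sum (List.map (λ k → ((multisetCount L (d ∸ k) ↑ scale k v) ↑ v) σ) (upTo (suc d)))
    ≡⟨ sum-map-↑ (λ k → multisetCount L (d ∸ k) ↑ scale k v) (upTo (suc d)) v σ ⟩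
  (multisetCount (v ∷ L) d ↑ v) σ ∎)
  where
  open ≡-Reasoning
  copies : ℕ → ℕ
  copies k = (multisetCount L (suc d ∸ k) ↑ scale k v) σ

multisetCount-vanishes : ∀ n (L : List (Vec ℕ m)) → All (λ v → vsum v ≤ n) L →
                         ∀ d σ → d * n < vsum σ → multisetCount L d σ ≡ 0
multisetCount-vanishes n []      _           zero    σ 0<σ  = isZeroVec-nonzero σ 0<σ
multisetCount-vanishes n []      _           (suc d) σ _    = refl
multisetCount-vanishes n (v ∷ L) (v≤n ∷ L≤n) zero    σ 0<σ  =
  trans (multisetCount-∷-zero v L σ) (multisetCount-vanishes n L L≤n 0 σ 0<σ)
multisetCount-vanishes n (v ∷ L) (v≤n ∷ L≤n) (suc d) σ dn<σ =
  trans (multisetCount-∷-suc v L d σ) (cong₂ _+_ (multisetCount-vanishes n L L≤n (suc d) σ dn<σ)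
    (↑-elim (_≡ 0) _ v σ refl λ r vr≡σ →
      multisetCount-vanishes n (v ∷ L) (v≤n ∷ L≤n) d r (remainder vr≡σ)))
  where
  remainder : ∀ {r} → vadd v r ≡ σ → d * n < vsum r
  remainder {r} vr≡σ = +-cancelˡ-< n (d * n) (vsum r) (begin-strict
    n + d * n       <⟨ dn<σ ⟩
    vsum σ          ≡⟨ vsum-split vr≡σ ⟨
    vsum v + vsum r ≤⟨ +-monoˡ-≤ (vsum r) v≤n ⟩
    n + vsum r      ∎)
    where open ≤-Reasoning

multisetCount-dropFirst : ∀ n (L : List (Vec ℕ (suc m))) → All (λ v → vsum v ≡ n) L →
                          ∀ d x σ → x + vsum σ ≡ d * n →
                          multisetCount L d (x ∷ σ) ≡ multisetCount (List.map dropFirst L) d σ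
multisetCount-dropFirst n []            _            zero    zero σ _ = refl
multisetCount-dropFirst n []            _            (suc d) x    σ _ = refl
multisetCount-dropFirst n ((y ∷ τ) ∷ L) (yτ≡n ∷ L≡n) zero    x    σ x+σ≡0 = begin
  multisetCount ((y ∷ τ) ∷ L) 0 (x ∷ σ)        ≡⟨ multisetCount-∷-zero (y ∷ τ) L (x ∷ σ) ⟩
  multisetCount L 0 (x ∷ σ)                    ≡⟨ multisetCount-dropFirst n L L≡n 0 x σ x+σ≡0 ⟩
  multisetCount (List.map dropFirst L) 0 σ     ≡⟨ multisetCount-∷-zero τ (List.map dropFirst L) σ ⟨
  multisetCount (τ ∷ List.map dropFirst L) 0 σ ∎
  where open ≡-Reasoning
multisetCount-dropFirst {m} n ((y ∷ τ) ∷ L) (yτ≡n ∷ L≡n) (suc d) x σ x+σ≡n+dn = begin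
  multisetCount ((y ∷ τ) ∷ L) (suc d) (x ∷ σ)
    ≡⟨ multisetCount-∷-suc (y ∷ τ) L d (x ∷ σ) ⟩
  multisetCount L (suc d) (x ∷ σ) + (multisetCount ((y ∷ τ) ∷ L) d ↑ (y ∷ τ)) (x ∷ σ)
    ≡⟨ cong₂ _+_ (multisetCount-dropFirst n L L≡n (suc d) x σ x+σ≡n+dn) (shifted (y ≤? x)) ⟩
  multisetCount L′ (suc d) σ + (multisetCount (τ ∷ L′) d ↑ τ) σ
    ≡⟨ multisetCount-∷-suc τ L′ d σ ⟨
  multisetCount (τ ∷ L′) (suc d) σ ∎
  where
  open ≡-Reasoning
  L′ : List (Vec ℕ m)
  L′ = List.map dropFirst L

  balance : ∀ {r} → vadd τ r ≡ σ → x + vsum r ≡ y + d * n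
  balance {r} τr≡σ = +-cancelˡ-≡ (vsum τ) (x + vsum r) (y + d * n) (begin
    vsum τ + (x + vsum r) ≡⟨ x∙yz≈y∙xz (vsum τ) x (vsum r) ⟩
    x + (vsum τ + vsum r) ≡⟨ cong (_+_ x) (vsum-split τr≡σ) ⟩
    x + vsum σ            ≡⟨ x+σ≡n+dn ⟩
    n + d * n             ≡⟨ cong (_+ d * n) yτ≡n ⟨
    y + vsum τ + d * n    ≡⟨ xy∙z≈y∙xz y (vsum τ) (d * n) ⟩
    vsum τ + (y + d * n)  ∎)

  shifted : Dec (y ≤ x) →
            (multisetCount ((y ∷ τ) ∷ L) d ↑ (y ∷ τ)) (x ∷ σ) ≡ (multisetCount (τ ∷ L′) d ↑ τ) σ
  shifted (yes y≤x) = begin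
    maybe′ _ 0 (vsub? (x ∷ σ) (y ∷ τ))                 ≡⟨ cong (maybe′ _ 0) (vsub?-∷-≤ σ τ y≤x) ⟩
    maybe′ _ 0 (Maybe.map (x ∸ y ∷_) (vsub? σ τ))      ≡⟨ maybe′-map _ 0 (x ∸ y ∷_) (vsub? σ τ) ⟩
    maybe′ (multisetCount ((y ∷ τ) ∷ L) d ∘ (x ∸ y ∷_)) 0 (vsub? σ τ)
      ≡⟨ vsub?-maybe-cong σ τ (λ r τr≡σ →
           multisetCount-dropFirst n ((y ∷ τ) ∷ L) (yτ≡n ∷ L≡n) d (x ∸ y) r (begin
             x ∸ y + vsum r ≡⟨ +-∸-comm (vsum r) y≤x ⟨
             x + vsum r ∸ y ≡⟨ cong (_∸ y) (balance τr≡σ) ⟩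
             y + d * n ∸ y  ≡⟨ m+n∸m≡n y (d * n) ⟩
             d * n          ∎)) ⟩
    (multisetCount (τ ∷ L′) d ↑ τ) σ ∎
  shifted (no y≰x) = trans (cong (maybe′ _ 0) (vsub?-∷-≰ σ τ y≰x))
    (↑-elim (0 ≡_) _ τ σ refl λ r τr≡σ →
      sym (multisetCount-vanishes n (τ ∷ L′) (dropFirst-bounded (yτ≡n ∷ L≡n)) d r (excess τr≡σ)))
    where
    excess : ∀ {r} → vadd τ r ≡ σ → d * n < vsum r
    excess {r} τr≡σ = +-cancelˡ-< x (d * n) (vsum r)
      (subst (x + d * n <_) (sym (balance τr≡σ)) (+-monoˡ-< (d * n) (≰⇒> y≰x)))

multisetCount-zeroVec : ∀ d (σ : Vec ℕ m) →
                        multisetCount (Vec.replicate m 0 ∷ []) d σ ≡ isZeroVec σ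
multisetCount-zeroVec zero    σ = multisetCount-∷-zero _ [] σ
multisetCount-zeroVec (suc d) σ = trans (multisetCount-∷-suc _ [] d σ)
  (trans (cong (maybe′ _ 0) (vsub?-zero σ)) (multisetCount-zeroVec d σ))

multisetCount-stable : ∀ (L : List (Vec ℕ m)) → All (λ v → 0 < vsum v) L → ∀ d σ → vsum σ ≤ d →
                       multisetCount (L List.∷ʳ Vec.replicate m 0) (suc d) σ ≡
                       multisetCount (L List.∷ʳ Vec.replicate m 0) d σ
multisetCount-stable []      _           d       σ _   =
  trans (multisetCount-zeroVec (suc d) σ) (sym (multisetCount-zeroVec d σ))
multisetCount-stable {m} (v ∷ L) (0<v ∷ 0<L) zero    σ σ≤0 = begin
  multisetCount (v ∷ L′) 1 σ                               ≡⟨ multisetCount-∷-suc v L′ 0 σ ⟩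
  multisetCount L′ 1 σ + (multisetCount (v ∷ L′) 0 ↑ v) σ
    ≡⟨ cong₂ _+_ (multisetCount-stable L 0<L 0 σ σ≤0)
                 (↑-elim (_≡ 0) _ v σ refl λ _ vr≡σ → ⊥-elim (v≰σ vr≡σ)) ⟩
  multisetCount L′ 0 σ + 0                                 ≡⟨ +-identityʳ _ ⟩
  multisetCount L′ 0 σ                                     ≡⟨ multisetCount-∷-zero v L′ σ ⟨
  multisetCount (v ∷ L′) 0 σ                               ∎
  where
  open ≡-Reasoning
  L′ : List (Vec ℕ m)
  L′ = L List.∷ʳ Vec.replicate m 0
  v≰σ : ∀ {r} → vadd v r ≢ σ
  v≰σ {r} vr≡σ = <⇒≱ 0<v (≤-trans (m≤m+n (vsum v) (vsum r)) (subst (_≤ 0) (sym (vsum-split vr≡σ)) σ≤0))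
multisetCount-stable {m} (v ∷ L) (0<v ∷ 0<L) (suc d) σ σ≤1+d = begin
  multisetCount (v ∷ L′) (suc (suc d)) σ
    ≡⟨ multisetCount-∷-suc v L′ (suc d) σ ⟩
  multisetCount L′ (suc (suc d)) σ + (multisetCount (v ∷ L′) (suc d) ↑ v) σ
    ≡⟨ cong₂ _+_ (multisetCount-stable L 0<L (suc d) σ σ≤1+d)
                 (vsub?-maybe-cong σ v λ r vr≡σ → multisetCount-stable (v ∷ L) (0<v ∷ 0<L) d r (r≤d vr≡σ)) ⟩
  multisetCount L′ (suc d) σ + (multisetCount (v ∷ L′) d ↑ v) σ
    ≡⟨ multisetCount-∷-suc v L′ d σ ⟨
  multisetCount (v ∷ L′) (suc d) σ
    ∎
  where
  open ≡-Reasoning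
  L′ : List (Vec ℕ m)
  L′ = L List.∷ʳ Vec.replicate m 0
  r≤d : ∀ {r} → vadd v r ≡ σ → vsum r ≤ d
  r≤d {r} vr≡σ = s≤s⁻¹ (≤-trans (+-monoˡ-≤ (vsum r) 0<v) (subst (_≤ suc d) (sym (vsum-split vr≡σ)) σ≤1+d))

multisetCount-stable-≥ : ∀ (L : List (Vec ℕ m)) → All (λ v → 0 < vsum v) L →
                         ∀ {D d} σ → vsum σ ≤ D → D ≤′ d →
                         multisetCount (L List.∷ʳ Vec.replicate m 0) d σ ≡
                         multisetCount (L List.∷ʳ Vec.replicate m 0) D σ
multisetCount-stable-≥ L 0<L σ σ≤D ≤′-refl        = refl
multisetCount-stable-≥ L 0<L σ σ≤D (≤′-step D≤′d) =
  trans (multisetCount-stable L 0<L _ σ (≤-trans σ≤D (≤′⇒≤ D≤′d)))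
        (multisetCount-stable-≥ L 0<L σ σ≤D D≤′d)

multisetCount-capped : ∀ (L : List (Vec ℕ m)) → All (λ v → 0 < vsum v) L → ∀ D d σ → vsum σ ≤ D →
                       multisetCount (L List.∷ʳ Vec.replicate m 0) d σ ≡
                       multisetCount (L List.∷ʳ Vec.replicate m 0) (d ⊓ D) σ
multisetCount-capped L 0<L D d σ σ≤D with ≤-total d D
... | inj₁ d≤D = cong (λ d′ → multisetCount (L List.∷ʳ _) d′ σ) (sym (m≤n⇒m⊓n≡m d≤D))
... | inj₂ D≤d = trans (multisetCount-stable-≥ L 0<L σ σ≤D (≤⇒≤′ D≤d))
                       (cong (λ d′ → multisetCount (L List.∷ʳ _) d′ σ) (sym (m≥n⇒m⊓n≡n D≤d)))

monomials-homogeneous : ∀ m n → All (λ v → vsum v ≡ n) (monomials m n)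
monomials-homogeneous zero    zero    = refl ∷ []
monomials-homogeneous zero    (suc n) = []
monomials-homogeneous (suc m) n       =
  All.concat⁺ (All.map⁺ (All.applyUpTo⁺₁ _ (suc n) λ {k} k<1+n →
    All.gmap⁺ (λ v≡n∸k → trans (cong (_+_ k) v≡n∸k) (m+[n∸m]≡n (s≤s⁻¹ k<1+n)))
              (monomials-homogeneous m (n ∸ k))))

tailMonomials : ∀ m n → List (Vec ℕ m)
tailMonomials m n = List.map dropFirst (monomials (suc m) n)

-- Dense polynomials in k variables: entry i of a list is the coefficient of x₁^i.
Poly : ℕ → Set
Poly zero    = ℕ
Poly (suc k) = List (Poly k)

0ₚ 1ₚ : ∀ {k} → Poly k
0ₚ {zero}  = 0
0ₚ {suc k} = []
1ₚ {zero}  = 1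
1ₚ {suc k} = 1ₚ ∷ []

coeff : ∀ {k} → Poly k → Vec ℕ k → ℕ
coeff {zero}  c        []          = c
coeff {suc k} []       (_ ∷ _)     = 0
coeff {suc k} (p ∷ ps) (zero ∷ σ)  = coeff p σ
coeff {suc k} (p ∷ ps) (suc i ∷ σ) = coeff ps (i ∷ σ)

_+ₚ_ : ∀ {k} → Poly k → Poly k → Poly k
_+ₚ_ {zero}  a        b        = a + b
_+ₚ_ {suc k} []       qs       = qs
_+ₚ_ {suc k} (p ∷ ps) []       = p ∷ ps
_+ₚ_ {suc k} (p ∷ ps) (q ∷ qs) = p +ₚ q ∷ ps +ₚ qs

shift : ∀ {k} → Vec ℕ k → Poly k → Poly k
shift []      c  = c
shift (s ∷ v) ps = List.replicate s 0ₚ List.++ List.map (shift v) ps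

truncate : ∀ {k} → Vec ℕ k → Poly k → Poly k
truncate []      c  = c
truncate (b ∷ v) ps = List.map (truncate v) (List.take b ps)

coeff-0ₚ : ∀ {k} (σ : Vec ℕ k) → coeff 0ₚ σ ≡ 0
coeff-0ₚ []      = refl
coeff-0ₚ (_ ∷ _) = refl

coeff-1ₚ : ∀ {k} (σ : Vec ℕ k) → coeff 1ₚ σ ≡ isZeroVec σ
coeff-1ₚ []          = refl
coeff-1ₚ (zero ∷ σ)  = coeff-1ₚ σ
coeff-1ₚ (suc _ ∷ _) = refl

coeff-+ₚ : ∀ {k} (p q : Poly k) σ → coeff (p +ₚ q) σ ≡ coeff p σ + coeff q σ
coeff-+ₚ {zero}  p        q        []          = refl
coeff-+ₚ {suc k} []       qs       (_ ∷ _)     = refl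
coeff-+ₚ {suc k} (p ∷ ps) []       σ@(_ ∷ _)   = sym (+-identityʳ _)
coeff-+ₚ {suc k} (p ∷ ps) (q ∷ qs) (zero ∷ σ)  = coeff-+ₚ p q σ
coeff-+ₚ {suc k} (p ∷ ps) (q ∷ qs) (suc i ∷ σ) = coeff-+ₚ ps qs (i ∷ σ)

coeff-shift : ∀ {k} (v : Vec ℕ k) p σ → coeff (shift v p) σ ≡ (coeff p ↑ v) σ
coeff-shift []      c  []      = refl
coeff-shift (s ∷ v) ps (i ∷ σ) = padded s i
  where
  unpadded : ∀ ps i → coeff (List.map (shift v) ps) (i ∷ σ) ≡ ((λ τ → coeff ps (i ∷ τ)) ↑ v) σ
  unpadded []       i       = ↑-elim (0 ≡_) (λ _ → 0) v σ refl (λ _ _ → refl)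
  unpadded (p ∷ ps) zero    = coeff-shift v p σ
  unpadded (p ∷ ps) (suc i) = unpadded ps i

  padded : ∀ s i → coeff (List.replicate s 0ₚ List.++ List.map (shift v) ps) (i ∷ σ) ≡
                   (coeff ps ↑ (s ∷ v)) (i ∷ σ)
  padded zero    i       = trans (unpadded ps i) (sym (trans
    (cong (maybe′ (coeff ps) 0) (vsub?-∷-≤ σ v z≤n)) (maybe′-map (coeff ps) 0 (i ∷_) (vsub? σ v))))
  padded (suc s) zero    = coeff-0ₚ σ
  padded (suc s) (suc i) = trans (padded s i) (cong (maybe′ (coeff ps) 0) (sym (vsub?-suc i s σ v)))

coeff-truncate : ∀ {k} (b : Vec ℕ k) p σ → σ <ᵥ b → coeff (truncate b p) σ ≡ coeff p σ
coeff-truncate []       c  []      []           = refl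
coeff-truncate (b ∷ bs) ps (i ∷ σ) (i<b ∷ σ<bs) = truncated b ps i i<b
  where
  truncated : ∀ b ps i → i < b →
              coeff (List.map (truncate bs) (List.take b ps)) (i ∷ σ) ≡ coeff ps (i ∷ σ)
  truncated (suc b) []       i       _         = refl
  truncated (suc b) (p ∷ ps) zero    _         = coeff-truncate bs p σ σ<bs
  truncated (suc b) (p ∷ ps) (suc i) (s≤s i<b) = truncated b ps i i<b

scanl : ∀ {A B : Set} {n} → (B → A → B) → B → Vec A n → Vec B (suc n)
scanl f e []       = e ∷ []
scanl f e (x ∷ xs) = e ∷ scanl f (f e x) xs

scanl-invariant : ∀ {A B : Set} {n} (P : ℕ → B → Set) (Q : ℕ → A → Set) (f : B → A → B) e (xs : Vec A n) →
                  (∀ {j b a} → P j b → Q j a → P (suc j) (f b a)) →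
                  P 0 e → (∀ i → Q (toℕ i) (Vec.lookup xs i)) →
                  ∀ i → P (toℕ i) (Vec.lookup (scanl f e xs) i)
scanl-invariant P Q f e []       next Pe Qxs zero    = Pe
scanl-invariant P Q f e (_ ∷ _)  next Pe Qxs zero    = Pe
scanl-invariant P Q f e (x ∷ xs) next Pe Qxs (suc i) =
  scanl-invariant (P ∘ suc) (Q ∘ suc) f (f e x) xs next (next Pe (Qxs zero)) (Qxs ∘ suc) i

module _ {k} (box : Vec ℕ k) where

  Represents : Poly k → (Vec ℕ k → ℕ) → Set
  Represents p f = ∀ σ → σ <ᵥ box → coeff p σ ≡ f σ

  Tabulates : ∀ {n} → Vec (Poly k) n → (ℕ → Vec ℕ k → ℕ) → Set
  Tabulates T f = ∀ i → Represents (Vec.lookup T i) (f (toℕ i))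

  shift-Represents : ∀ {p f} v → Represents p f → Represents (shift v p) (f ↑ v)
  shift-Represents {p} v p≈f σ σ<box = trans (coeff-shift v p σ) (vsub?-maybe-cong σ v λ r vr≡σ →
    p≈f r (Pointwise.trans ≤-<-trans (subst (r ≤ᵥ_) vr≡σ (≤ᵥ-vadd v r)) σ<box))

  step : Vec ℕ k → Poly k → Poly k → Poly k
  step v prev p = truncate box (p +ₚ shift v prev)

  extend : ∀ {n} → Vec ℕ k → Vec (Poly k) (suc n) → Vec (Poly k) (suc n)
  extend v (p ∷ ps) = scanl (step v) p ps

  table : ∀ n → List (Vec ℕ k) → Vec (Poly k) (suc n)
  table n = List.foldr extend (1ₚ ∷ Vec.replicate n 0ₚ)

  extend-Tabulates : ∀ {n} v L (T : Vec (Poly k) (suc n)) →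
                     Tabulates T (multisetCount L) → Tabulates (extend v T) (multisetCount (v ∷ L))
  extend-Tabulates v L (p ∷ ps) T≈ =
    scanl-invariant (λ j b → Represents b (multisetCount (v ∷ L) j))
                    (λ j a → Represents a (multisetCount L (suc j)))
                    (step v) p ps next first (T≈ ∘ suc)
    where
    first : Represents p (multisetCount (v ∷ L) 0)
    first σ σ<box = trans (T≈ zero σ σ<box) (sym (multisetCount-∷-zero v L σ))

    next : ∀ {j b a} → Represents b (multisetCount (v ∷ L) j) → Represents a (multisetCount L (suc j)) →
           Represents (step v b a) (multisetCount (v ∷ L) (suc j))
    next {j} {b} {a} b≈ a≈ σ σ<box = begin
      coeff (truncate box (a +ₚ shift v b)) σ
        ≡⟨ coeff-truncate box _ σ σ<box ⟩
      coeff (a +ₚ shift v b) σ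
        ≡⟨ coeff-+ₚ a (shift v b) σ ⟩
      coeff a σ + coeff (shift v b) σ
        ≡⟨ cong₂ _+_ (a≈ σ σ<box) (shift-Represents v b≈ σ σ<box) ⟩
      multisetCount L (suc j) σ + (multisetCount (v ∷ L) j ↑ v) σ
        ≡⟨ multisetCount-∷-suc v L j σ ⟨
      multisetCount (v ∷ L) (suc j) σ
        ∎
      where open ≡-Reasoning

  table-Tabulates : ∀ n L → Tabulates (table n L) (multisetCount L)
  table-Tabulates n []      zero    σ _ = coeff-1ₚ σ
  table-Tabulates n []      (suc i) σ _ = trans (cong (λ p → coeff p σ) (lookup-replicate i 0ₚ)) (coeff-0ₚ σ)
  table-Tabulates n (v ∷ L) = extend-Tabulates v L (table n L) (table-Tabulates n L)

  -- Stated for any K equal to L ∷ʳ 0: rewriting a concrete list into that form instead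
  -- makes Agda unfold multisetCount on it while comparing types.
  table-capped : ∀ D L → All (λ v → 0 < vsum v) L → (∀ σ → σ <ᵥ box → vsum σ ≤ D) →
                 ∀ K → K ≡ L List.∷ʳ Vec.replicate k 0 → ∀ d (i : Fin (suc D)) → toℕ i ≡ d ⊓ D →
                 Represents (Vec.lookup (table D K) i) (multisetCount K d)
  table-capped D L 0<L bounded _ refl d i i≡d⊓D σ σ<box = begin
    coeff (Vec.lookup (table D K) i) σ ≡⟨ table-Tabulates D K i σ σ<box ⟩
    multisetCount K (toℕ i) σ          ≡⟨ cong (λ d′ → multisetCount K d′ σ) i≡d⊓D ⟩
    multisetCount K (d ⊓ D) σ          ≡⟨ multisetCount-capped L 0<L D d σ (bounded σ σ<box) ⟨
    multisetCount K d σ                ∎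
    where
    open ≡-Reasoning
    K : List (Vec ℕ k)
    K = L List.∷ʳ Vec.replicate k 0

tailAlternantTerm : (Vec ℕ m → ℕ) → Vec ℕ m → ℤ × Vec ℕ (suc m) → ℤ
tailAlternantTerm {m} f t (s , wδ) = s ℤ.* maybe′ (λ σ → + f σ) (+ 0) (vsub? (vadd t (staircase m)) (dropFirst wδ))

tailAlternant : (Vec ℕ m → ℕ) → Vec ℕ m → ℤ
tailAlternant {m} f t = sumℤ (List.map (tailAlternantTerm f t) (signedPerms (staircase (suc m))))

tailAlternant-cong : ∀ {m} (f g : Vec ℕ m → ℕ) t → (∀ σ → σ ≤ᵥ vadd t (staircase m) → f σ ≡ g σ) →
                     tailAlternant f t ≡ tailAlternant g t
tailAlternant-cong {m} f g t f≡g = cong sumℤ (map-cong termwise (signedPerms (staircase (suc m))))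
  where
  termwise : ∀ p → tailAlternantTerm f t p ≡ tailAlternantTerm g t p
  termwise (s , wδ) = cong (s ℤ.*_) (vsub?-maybe-cong _ (dropFirst wδ) λ r ys+r≡t+δ →
    cong +_ (f≡g r (subst (r ≤ᵥ_) ys+r≡t+δ (≤ᵥ-vadd (dropFirst wδ) r))))

signedPerms-staircase₄ : All (λ { (_ , w) → Vec.head w ≤ 3 × vsum w ≡ 6 }) (signedPerms (staircase 4))
signedPerms-staircase₄ =
  from-yes (All.all? (λ { (_ , w) → (Vec.head w ≤? 3) ×-dec (vsum w ≟ 6) }) (signedPerms (staircase 4)))

plethysmCoeff-tailAlternant : ∀ d n a t → a + vsum t ≡ d * n →
                              plethysmCoeff 4 d n (a ∷ t) ≡ tailAlternant (multisetCount (tailMonomials 3 n) d) t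
plethysmCoeff-tailAlternant d n a t a+t≡dn =
  cong sumℤ (map-cong-local {f = plethysmTerm} {g = tailAlternantTerm (multisetCount (tailMonomials 3 n) d) t}
    (All.map (λ { {s , y ∷ ys} (y≤3 , y+ys≡6) → cong (s ℤ.*_) (termwise {y} {ys} y≤3 y+ys≡6) })
             signedPerms-staircase₄))
  where
  t+δ : Vec ℕ 3
  t+δ = vadd t (staircase 3)

  plethysmTerm : ℤ × Vec ℕ 4 → ℤ
  plethysmTerm (s , wδ) = s ℤ.* maybe′ (λ μ → + hdhnCoeff 4 d n μ) (+ 0) (vsub? (vadd (a ∷ t) (staircase 4)) wδ)

  y≤a+3 : ∀ {y} → y ≤ 3 → y ≤ a + 3
  y≤a+3 y≤3 = ≤-trans y≤3 (m≤n+m 3 a)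

  degree : ∀ {y ys r} → y ≤ 3 → y + vsum ys ≡ 6 → vadd ys r ≡ t+δ → a + 3 ∸ y + vsum r ≡ d * n
  degree {y} {ys} {r} y≤3 y+ys≡6 ys+r≡t+δ = +-cancelʳ-≡ 6 _ _ (begin
    a + 3 ∸ y + vsum r + 6             ≡⟨ cong (_+_ (a + 3 ∸ y + vsum r)) y+ys≡6 ⟨
    a + 3 ∸ y + vsum r + (y + vsum ys) ≡⟨ interchange (a + 3 ∸ y) (vsum r) y (vsum ys) ⟩
    a + 3 ∸ y + y + (vsum r + vsum ys) ≡⟨ cong₂ _+_ (m∸n+n≡m (y≤a+3 y≤3)) (+-comm (vsum r) (vsum ys)) ⟩
    a + 3 + (vsum ys + vsum r)         ≡⟨ cong (_+_ (a + 3)) (vsum-split ys+r≡t+δ) ⟩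
    a + 3 + vsum t+δ                   ≡⟨ cong (_+_ (a + 3)) (vsum-vadd t (staircase 3)) ⟩
    a + 3 + (vsum t + 3)               ≡⟨ interchange a 3 (vsum t) 3 ⟩
    a + vsum t + 6                     ≡⟨ cong (_+ 6) a+t≡dn ⟩
    d * n + 6                          ∎)
    where open ≡-Reasoning

  termwise : ∀ {y ys} → y ≤ 3 → y + vsum ys ≡ 6 →
             maybe′ (λ μ → + hdhnCoeff 4 d n μ) (+ 0) (vsub? (a + 3 ∷ t+δ) (y ∷ ys)) ≡
             maybe′ (λ σ → + multisetCount (tailMonomials 3 n) d σ) (+ 0) (vsub? t+δ ys)
  termwise {y} {ys} y≤3 y+ys≡6 = begin
    maybe′ (λ μ → + hdhnCoeff 4 d n μ) (+ 0) (vsub? (a + 3 ∷ t+δ) (y ∷ ys))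
      ≡⟨ cong (maybe′ _ _) (vsub?-∷-≤ t+δ ys (y≤a+3 y≤3)) ⟩
    maybe′ (λ μ → + hdhnCoeff 4 d n μ) (+ 0) (Maybe.map (a + 3 ∸ y ∷_) (vsub? t+δ ys))
      ≡⟨ maybe′-map _ _ _ (vsub? t+δ ys) ⟩
    maybe′ (λ r → + hdhnCoeff 4 d n (a + 3 ∸ y ∷ r)) (+ 0) (vsub? t+δ ys)
      ≡⟨ vsub?-maybe-cong t+δ ys (λ r ys+r≡t+δ → cong +_ (multisetCount-dropFirst n (monomials 4 n)
           (monomials-homogeneous 4 n) d _ r (degree y≤3 y+ys≡6 ys+r≡t+δ))) ⟩
    maybe′ (λ σ → + multisetCount (tailMonomials 3 n) d σ) (+ 0) (vsub? t+δ ys) ∎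
    where open ≡-Reasoning

-- One more than the componentwise maximum of t + δ̄ over t ∈ Y.
box : Vec ℕ 3
box = 9 ∷ 7 ∷ 6 ∷ []

vsum-below-box : ∀ σ → σ <ᵥ box → vsum σ ≤ 19
vsum-below-box (a ∷ b ∷ c ∷ []) (a<9 ∷ b<7 ∷ c<6 ∷ []) =
  +-mono-≤ (s≤s⁻¹ a<9) (+-mono-≤ (s≤s⁻¹ b<7) (+-mono-≤ (s≤s⁻¹ c<6) z≤n))

Y-nonzero : All (λ t → 0 < vsum t) Y
Y-nonzero = from-yes (All.all? (λ t → 0 <? vsum t) Y)

Y-below-box : All (λ t → vadd t (staircase 3) <ᵥ box) Y
Y-below-box = from-yes (All.all? (λ t → Pointwise.decidable _<?_ (vadd t (staircase 3)) box) Y)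

isZero : ℤ → Bool
isZero (+ 0) = true
isZero _     = false

isZero-sound : ∀ z → T (isZero z) → z ≡ + 0
isZero-sound (+ 0) _ = refl

vanishesAt : Vec (Poly 3) (suc 19) → Vec ℕ 3 → Fin 19 → Bool
vanishesAt tab t i = isZero (tailAlternant (coeff (Vec.lookup tab (suc i))) t)

vanishes? : Vec (Poly 3) (suc 19) → Bool
vanishes? tab = all (λ t → all (vanishesAt tab t) (List.allFin 19)) Y

vanishes?-sound : ∀ tab → vanishes? tab ≡ true →
                  ∀ {t} → t ∈ Y → ∀ i → tailAlternant (coeff (Vec.lookup tab (suc i))) t ≡ + 0
vanishes?-sound tab ok {t} t∈Y i = isZero-sound (tailAlternant (coeff (Vec.lookup tab (suc i))) t)
  (All.lookup (All.all⁺ (vanishesAt tab t) (List.allFin 19)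
    (All.lookup (All.all⁺ (λ t → all (vanishesAt tab t) (List.allFin 19)) Y (subst T (sym ok) tt)) t∈Y))
    (∈-allFin i))

-- Closed by refl on a Boolean check: with from-yes on a decision procedure instead, type
-- checking runs out of memory, and stated with T it is several times slower.
table-vanishes : vanishes? (table box 19 (tailMonomials 3 7)) ≡ true
table-vanishes = refl

nonzeroTails : List (Vec ℕ 3)
nonzeroTails = List.filter (λ v → 0 <? vsum v) (tailMonomials 3 7)

tailMonomials-split : tailMonomials 3 7 ≡ nonzeroTails List.∷ʳ Vec.replicate 3 0
tailMonomials-split = refl

cap : ℕ → Fin 19
cap e = fromℕ< (s≤s (m⊓n≤n e 18))

toℕ-suc-cap : ∀ e → toℕ (suc (cap e)) ≡ suc e ⊓ 19
toℕ-suc-cap e = cong suc (toℕ-fromℕ< _)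

tailCount-table : ∀ e → Represents box (Vec.lookup (table box 19 (tailMonomials 3 7)) (suc (cap e)))
                                       (multisetCount (tailMonomials 3 7) (suc e))
tailCount-table e =
  table-capped box 19 nonzeroTails (All.all-filter (λ v → 0 <? vsum v) (tailMonomials 3 7)) vsum-below-box
               (tailMonomials 3 7) tailMonomials-split (suc e) (suc (cap e)) (toℕ-suc-cap e)

-- The length of tab is written suc 19, as in the type of table: with 20, its instantiation in
-- lemma10 is not syntactically equal to the expected type, and Agda evaluates the whole table
-- to compare them.
module _ (tab : Vec (Poly 3) (suc 19))
         (tab-counts : ∀ e → Represents box (Vec.lookup tab (suc (cap e)))
                                            (multisetCount (tailMonomials 3 7) (suc e)))
         (tab-vanishes : vanishes? tab ≡ true) where

  plethysmCoeff-vanishes : (d : ℕ) (λ′ : Vec ℕ 4) → IsPartition 4 (d * 7) λ′ →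
                           dropFirst λ′ ∈ Y → plethysmCoeff 4 d 7 λ′ ≡ + 0
  plethysmCoeff-vanishes zero    (a ∷ t) (_ , a+t≡0)  t∈Y =
    ⊥-elim (<⇒≢ (All.lookup Y-nonzero t∈Y) (sym (m+n≡0⇒n≡0 a a+t≡0)))
  plethysmCoeff-vanishes (suc e) (a ∷ t) (_ , a+t≡dn) t∈Y = begin
    plethysmCoeff 4 (suc e) 7 (a ∷ t)
      ≡⟨ plethysmCoeff-tailAlternant (suc e) 7 a t a+t≡dn ⟩
    tailAlternant (multisetCount (tailMonomials 3 7) (suc e)) t
      ≡⟨ tailAlternant-cong _ _ t (λ σ σ≤t+δ →
           sym (tab-counts e σ (Pointwise.trans ≤-<-trans σ≤t+δ t+δ<box))) ⟩
    tailAlternant (coeff (Vec.lookup tab (suc (cap e)))) t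
      ≡⟨ vanishes?-sound tab tab-vanishes t∈Y (cap e) ⟩
    + 0 ∎
    where
    open ≡-Reasoning
    t+δ<box : vadd t (staircase 3) <ᵥ box
    t+δ<box = All.lookup Y-below-box t∈Y

lemma10 : (d : ℕ) (λ′ : Vec ℕ 4) → IsPartition 4 (d * 7) λ′ →
    dropFirst λ′ ∈ Y → plethysmCoeff 4 d 7 λ′ ≡ + 0
lemma10 = plethysmCoeff-vanishes (table box 19 (tailMonomials 3 7)) tailCount-table table-vanishes
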